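{- Let $\widetilde{P}(x,u,q)=\sum_{k\geq1}\sum_{n\geq k}\sum_{\pi\in P_{n,k}}\frac{x^nu^kq^{\mathrm{swrec}(\pi)}}{n!}$. Then $$\frac{\partial}{\partial q}\widetilde{P}(x,u,q)\Big|_{u=q=1}=e^{e^x-1}\left(\frac{3}{4}e^{3x}+\frac{3}{2}e^{2x}-\frac{7}{4}e^x-xe^{2x}-\frac{3}{2}xe^x-\frac{1}{2}\right).$$ Equivalently, $\sum_{n\geq0}\Big(\sum_{\pi\in P_n}\mathrm{swrec}(\pi)\Big)\frac{x^n}{n!}$ equals the right-hand side.
   Context: A partition of $[n]=\{1,\dots,n\}$ into exactly $k$ blocks is a collection $\{B_1,\dots,B_k\}$ of nonempty, pairwise disjoint subsets with union $[n]$, with $\min B_1<\cdots<\min B_k$. Its canonical sequential form is the word $\pi=\pi_1\cdots\pi_n$ where $i\in B_{\pi_i}$. $P_{n,k}$ denotes the set of partitions of $[n]$ with exactly $k$ blocks and $P_n=\bigcup_k P_{n,k}$ the set of all partitions of $[n]$, identified with their canonical sequential forms. In a word $\pi=\pi_1\cdots\pi_n$, the entry $\pi_i$ is a record (at position $i$) if $\pi_i>\pi_j$ for all $j<i$. The statistic $\mathrm{swrec}(\pi)$ is the sum over all records $\pi_i$ of $\pi$ of $i\cdot\pi_i$. -}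

module Defs where

open import Data.Nat as ℕ using (ℕ; zero; suc; _!; _≤?_; _<ᵇ_)
open import Data.Nat.Properties using (_!≢0)
open import Data.Bool using (Bool; true; false; if_then_else_)
open import Data.List using (List; []; _∷_; map; concatMap; filter; foldr; upTo)
open import Data.Integer using (+_)
open import Data.Rational using (ℚ; 0ℚ; 1ℚ; _+_; _*_; -_; _/_)
open import Relation.Nullary using (Dec; yes; no; ¬_)
open import Relation.Nullary.Decidable using (_×-dec_)
open import Relation.Binary.PropositionalEquality using (_≡_)
open import Data.Product using (_×_)
open import Data.Unit using (⊤; tt)
open import Data.Empty using (⊥)

-- Set partitions of [n] as canonical sequential forms (restricted growth
-- words): π₁ = 1 and π_i ≤ 1 + max(π₁ … π_{i-1}); letters are 1-based
-- block labels, the number of blocks is the maximal letter.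

RGS-from : ℕ → List ℕ → Set
RGS-from m []      = ⊤
RGS-from m (a ∷ w) = (1 ℕ.≤ a) × (a ℕ.≤ suc m) × RGS-from (ℕ._⊔_ m a) w

rgs? : (m : ℕ) → (w : List ℕ) → Dec (RGS-from m w)
rgs? m []      = yes tt
rgs? m (a ∷ w) = (1 ≤? a) ×-dec ((a ≤? suc m) ×-dec rgs? (ℕ._⊔_ m a) w)

IsCanonical : List ℕ → Set
IsCanonical w = RGS-from 0 w

words : ℕ → ℕ → List (List ℕ)
words n zero      = [] ∷ []
words n (suc len) = concatMap (λ a → map (a ∷_) (words n len)) (map suc (upTo n))

P : ℕ → List (List ℕ)
P n = filter (λ w → rgs? 0 w) (words n n)

-- swrec: sum of i·π_i over records π_i (π_i > π_j for all j < i).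
-- swrec-from i m w : w starts at position i, prefix maximum so far is m
-- (m = 0 for the empty prefix; all letters are ≥ 1).
swrec-from : ℕ → ℕ → List ℕ → ℕ
swrec-from i m []      = 0
swrec-from i m (a ∷ w) with m <ᵇ a
... | true  = i ℕ.* a ℕ.+ swrec-from (suc i) a w
... | false = swrec-from (suc i) m w

swrec : List ℕ → ℕ
swrec = swrec-from 1 0

sumℕ : List ℕ → ℕ
sumℕ = foldr ℕ._+_ 0

totalSwrec : ℕ → ℕ
totalSwrec n = sumℕ (map swrec (P n))

-- Formal power series over ℚ, as coefficient sequences (ordinary
-- coefficients: series n is the coefficient of x^n).
Series : Set
Series = ℕ → ℚ

sumℚ : List ℚ → ℚ
sumℚ = foldr _+_ 0ℚ

fromℕℚ : ℕ → ℚ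
fromℕℚ k = (+ k) / 1

invFact : ℕ → ℚ
invFact k = _/_ (+ 1) (k !) {{k !≢0}}

_⊕_ : Series → Series → Series
(f ⊕ g) n = f n + g n

_·_ : ℚ → Series → Series
(c · f) n = c * f n

_⊛_ : Series → Series → Series
(f ⊛ g) n = sumℚ (map (λ i → f i * g (n ℕ.∸ i)) (upTo (suc n)))

constS : ℚ → Series
constS c zero    = c
constS c (suc n) = 0ℚ

oneS : Series
oneS = constS 1ℚ

powS : Series → ℕ → Series
powS f zero    = oneS
powS f (suc k) = f ⊛ powS f k

xS : Series
xS (suc zero) = 1ℚ
xS _          = 0ℚ

expLin : ℕ → Series
expLin c n = fromℕℚ (c ℕ.^ n) * invFact n

-- exp(g) = Σ_k g^k / k!  for a series g with zero constant term; the
-- coefficient of x^n only involves k ≤ n.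
expComp : Series → Series
expComp g n = sumℚ (map (λ k → powS g k n * invFact k) (upTo (suc n)))

expMinusOne : Series
expMinusOne = expLin 1 ⊕ ((- 1ℚ) · oneS)

rhsInner : Series
rhsInner =
  (((((((+ 3) / 4) · expLin 3)
  ⊕ (((+ 3) / 2) · expLin 2))
  ⊕ ((- ((+ 7) / 4)) · expLin 1))
  ⊕ ((- 1ℚ) · (xS ⊛ expLin 2)))
  ⊕ ((- ((+ 3) / 2)) · (xS ⊛ expLin 1)))
  ⊕ ((- ((+ 1) / 2)) · oneS)

rhsSeries : Series
rhsSeries = expComp expMinusOne ⊛ rhsInner

lhsSeries : Series
lhsSeries n = fromℕℚ (totalSwrec n) * invFact n

-- Classify a partition word by the maximum m of its prefix so far.  The continuations of length L
-- of such a prefix are counted by the r-Bell number B(m, L), whose exponential generating function is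
-- e^{mx} e^{eˣ-1}.  Choosing the first letter (one of the m old blocks, or the new block m + 1, which
-- is a record) gives a recurrence for the total swrec S(i, m, L) of the continuations that start at
-- position i, and by induction on L, 4 S(i, m, L) is an explicit combination of the numbers B(m+k, L)
-- and L B(m+k, L-1) with coefficients polynomial in i and m.  At i = 1, m = 0 it reads
--   4 S(1, 0, n) = 3 B(3,n) + 6 B(2,n) - 7 B(1,n) - 4n B(2,n-1) - 6n B(1,n-1) - 2 B(0,n),
-- which is n! times the coefficient of xⁿ on the right-hand side.  On the series side, e^{eˣ-1} is
-- determined by its derivative eˣ e^{eˣ-1}, and every coefficient identity is proved by comparing
-- derivatives, which is possible because ℚ has characteristic zero.

module Submission where

open import Defs
open import Data.Nat using (ℕ)
open import Relation.Binary.PropositionalEquality using (_≡_)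

module RestrictedGrowth where

  open import Data.Nat using (zero; suc; _+_; _*_; _∸_; _≤_; _<_; _⊔_; _<ᵇ_; s≤s; z≤n)
  open import Data.Nat.Properties
    using (≤-refl; ≤-trans; <⇒≤; <⇒≱; ≤-pred; n≤1+n; n<1+n; +-suc; +-comm; +-identityʳ;
           *-zeroʳ; *-identityʳ; *-distribˡ-+; +-cancelʳ-≡; m≥n⇒m⊔n≡m; m≤n⇒m⊔n≡n; <ᵇ⇒<; <⇒<ᵇ;
           m+[n∸m]≡n; m≤m+n; m<m+n; <-≤-trans; +-monoʳ-≤)
  open import Data.Nat.ListAction.Properties using (sum-++)
  open import Data.Nat.Tactic.RingSolver using (solve-∀)
  open import Data.Bool using (true; false; if_then_else_; T)
  open import Data.List using (List; []; _∷_; map; concatMap; filter; upTo; _++_)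
  open import Data.List.Properties using (map-++; map-cong; map-∘; upTo-∷ʳ)
  open import Data.Product using (_,_; proj₁; proj₂)
  open import Data.Unit using (tt)
  open import Data.Empty using (⊥-elim)
  open import Function using (_∘_; const)
  open import Function.Bundles using (mk⇔)
  open import Relation.Nullary using (does)
  open import Relation.Nullary.Decidable using (does-⇔; dec-false)
  open import Relation.Unary using (Decidable)
  open import Relation.Binary.PropositionalEquality
    using (refl; sym; trans; cong; cong₂; subst; module ≡-Reasoning)

  sumMap : {A : Set} → (A → ℕ) → List A → ℕ
  sumMap h xs = sumℕ (map h xs)

  sumMap-++ : {A : Set} (h : A → ℕ) (xs ys : List A) →
              sumMap h (xs ++ ys) ≡ sumMap h xs + sumMap h ys
  sumMap-++ h xs ys = trans (cong sumℕ (map-++ h xs ys)) (sum-++ (map h xs) (map h ys))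

  sumMap-cong : {A : Set} {h h′ : A → ℕ} → (∀ x → h x ≡ h′ x) → (xs : List A) →
                sumMap h xs ≡ sumMap h′ xs
  sumMap-cong h≗h′ xs = cong sumℕ (map-cong h≗h′ xs)

  sumMap-zero : {A : Set} (xs : List A) → sumMap (const 0) xs ≡ 0
  sumMap-zero []       = refl
  sumMap-zero (x ∷ xs) = sumMap-zero xs

  sumMap-+ : {A : Set} (h h′ : A → ℕ) (xs : List A) →
             sumMap (λ x → h x + h′ x) xs ≡ sumMap h xs + sumMap h′ xs
  sumMap-+ h h′ []       = refl
  sumMap-+ h h′ (x ∷ xs) rewrite sumMap-+ h h′ xs = interchange (h x) (h′ x) (sumMap h xs) (sumMap h′ xs)
    where
    interchange : ∀ a b c d → a + b + (c + d) ≡ a + c + (b + d)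
    interchange = solve-∀

  sumMap-*ˡ : {A : Set} (c : ℕ) (h : A → ℕ) (xs : List A) →
              sumMap (λ x → c * h x) xs ≡ c * sumMap h xs
  sumMap-*ˡ c h []       = sym (*-zeroʳ c)
  sumMap-*ˡ c h (x ∷ xs) = trans (cong (c * h x +_) (sumMap-*ˡ c h xs)) (sym (*-distribˡ-+ c (h x) _))

  sumMap-filter : {A : Set} {P : A → Set} (P? : Decidable P) (h : A → ℕ) (xs : List A) →
    sumMap h (filter P? xs) ≡ sumMap (λ x → if does (P? x) then h x else 0) xs
  sumMap-filter P? h []       = refl
  sumMap-filter P? h (x ∷ xs) with does (P? x)
  ... | true  = cong (h x +_) (sumMap-filter P? h xs)
  ... | false = sumMap-filter P? h xs

  sumMap-upTo-suc : (φ : ℕ → ℕ) (K : ℕ) → sumMap φ (upTo (suc K)) ≡ sumMap φ (upTo K) + φ K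
  sumMap-upTo-suc φ K = begin
    sumMap φ (upTo (suc K))             ≡⟨ cong (sumMap φ) (sym (upTo-∷ʳ K)) ⟩
    sumMap φ (upTo K ++ K ∷ [])         ≡⟨ sumMap-++ φ (upTo K) (K ∷ []) ⟩
    sumMap φ (upTo K) + (φ K + 0)       ≡⟨ cong (sumMap φ (upTo K) +_) (+-identityʳ (φ K)) ⟩
    sumMap φ (upTo K) + φ K             ∎
    where open ≡-Reasoning

  sumMap-upTo-piecewise : (φ : ℕ → ℕ) {m A B : ℕ} →
    (∀ a → a < m → φ a ≡ A) → φ m ≡ B → (∀ a → m < a → φ a ≡ 0) →
    ∀ K → m < K → sumMap φ (upTo K) ≡ m * A + B
  sumMap-upTo-piecewise φ {m} {A} {B} below at above K m<K =
    trans (cong (sumMap φ ∘ upTo) (sym (m+[n∸m]≡n m<K))) (beyond (K ∸ suc m))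
    where
    upToBelow : ∀ k → k ≤ m → sumMap φ (upTo k) ≡ k * A
    upToBelow zero    _   = refl
    upToBelow (suc k) k<m = trans (sumMap-upTo-suc φ k)
      (trans (cong₂ _+_ (upToBelow k (<⇒≤ k<m)) (below k k<m)) (+-comm (k * A) A))
    beyond : ∀ d → sumMap φ (upTo (suc m + d)) ≡ m * A + B
    beyond zero    = trans (cong (sumMap φ ∘ upTo) (+-identityʳ (suc m)))
      (trans (sumMap-upTo-suc φ m) (cong₂ _+_ (upToBelow m ≤-refl) at))
    beyond (suc d) = trans (cong (sumMap φ ∘ upTo) (+-suc (suc m) d))
      (trans (sumMap-upTo-suc φ (suc m + d))
        (trans (cong₂ _+_ (beyond d) (above (suc m + d) (s≤s (m≤m+n m d)))) (+-identityʳ _)))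

  sumMap-words-suc : ∀ K L (h : List ℕ → ℕ) →
    sumMap h (words K (suc L)) ≡ sumMap (λ a → sumMap (λ w → h (suc a ∷ w)) (words K L)) (upTo K)
  sumMap-words-suc K L h = go (upTo K)
    where
    ws = words K L
    go : ∀ as → sumMap h (concatMap (λ a → map (a ∷_) ws) (map suc as))
                ≡ sumMap (λ a → sumMap (λ w → h (suc a ∷ w)) ws) as
    go []       = refl
    go (a ∷ as) = trans (sumMap-++ h (map (suc a ∷_) ws) _)
                        (cong₂ _+_ (cong sumℕ (sym (map-∘ ws))) (go as))

  whenRGS : ℕ → (List ℕ → ℕ) → List ℕ → ℕ
  whenRGS m h w = if does (rgs? m w) then h w else 0

  rgs?-∷ : ∀ m a w → 1 ≤ a → a ≤ suc m → does (rgs? m (a ∷ w)) ≡ does (rgs? (m ⊔ a) w)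
  rgs?-∷ m a w 1≤a a≤1+m =
    does-⇔ (mk⇔ (proj₂ ∘ proj₂) (λ r → 1≤a , a≤1+m , r)) (rgs? m (a ∷ w)) (rgs? (m ⊔ a) w)

  whenRGS-cong : ∀ m {h h′} → (∀ w → h w ≡ h′ w) → ∀ w → whenRGS m h w ≡ whenRGS m h′ w
  whenRGS-cong m h≗h′ w = cong (λ v → if does (rgs? m w) then v else 0) (h≗h′ w)

  whenRGS-old : ∀ m a h w → a < m → whenRGS m h (suc a ∷ w) ≡ whenRGS m (λ v → h (suc a ∷ v)) w
  whenRGS-old m a h w a<m =
    cong (λ b → if b then h (suc a ∷ w) else 0)
         (trans (rgs?-∷ m (suc a) w (s≤s z≤n) (s≤s (<⇒≤ a<m)))
                (cong (λ k → does (rgs? k w)) (m≥n⇒m⊔n≡m a<m)))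

  whenRGS-new : ∀ m h w → whenRGS m h (suc m ∷ w) ≡ whenRGS (suc m) (λ v → h (suc m ∷ v)) w
  whenRGS-new m h w =
    cong (λ b → if b then h (suc m ∷ w) else 0)
         (trans (rgs?-∷ m (suc m) w (s≤s z≤n) ≤-refl)
                (cong (λ k → does (rgs? k w)) (m≤n⇒m⊔n≡n (n≤1+n m))))

  whenRGS-invalid : ∀ m a h w → m < a → whenRGS m h (suc a ∷ w) ≡ 0
  whenRGS-invalid m a h w m<a =
    cong (λ b → if b then h (suc a ∷ w) else 0)
         (dec-false (rgs? m (suc a ∷ w)) (<⇒≱ m<a ∘ ≤-pred ∘ proj₁ ∘ proj₂))

  sumMap-whenRGS-+ : ∀ m c h ws →
    sumMap (whenRGS m (λ w → c + h w)) ws ≡ c * sumMap (whenRGS m (const 1)) ws + sumMap (whenRGS m h) ws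
  sumMap-whenRGS-+ m c h ws = begin
    sumMap (whenRGS m (λ w → c + h w)) ws
      ≡⟨ sumMap-cong split ws ⟩
    sumMap (λ w → c * whenRGS m (const 1) w + whenRGS m h w) ws
      ≡⟨ sumMap-+ (λ w → c * whenRGS m (const 1) w) (whenRGS m h) ws ⟩
    sumMap (λ w → c * whenRGS m (const 1) w) ws + sumMap (whenRGS m h) ws
      ≡⟨ cong (_+ sumMap (whenRGS m h) ws) (sumMap-*ˡ c (whenRGS m (const 1)) ws) ⟩
    c * sumMap (whenRGS m (const 1)) ws + sumMap (whenRGS m h) ws ∎
    where
    open ≡-Reasoning
    split : ∀ w → whenRGS m (λ v → c + h v) w ≡ c * whenRGS m (const 1) w + whenRGS m h w
    split w with does (rgs? m w)
    ... | true  = cong (_+ h w) (sym (*-identityʳ c))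
    ... | false = sym (cong (_+ 0) (*-zeroʳ c))

  sumMap-whenRGS-firstLetter : ∀ {K L m} (h old new : List ℕ → ℕ) → m < K →
    (∀ a → a < m → ∀ w → h (suc a ∷ w) ≡ old w) → (∀ w → h (suc m ∷ w) ≡ new w) →
    sumMap (whenRGS m h) (words K (suc L))
      ≡ m * sumMap (whenRGS m old) (words K L) + sumMap (whenRGS (suc m) new) (words K L)
  sumMap-whenRGS-firstLetter {K} {L} {m} h old new m<K h-old h-new =
    trans (sumMap-words-suc K L (whenRGS m h))
          (sumMap-upTo-piecewise _
            (λ a a<m → sumMap-cong (λ w → trans (whenRGS-old m a h w a<m)
                                                (whenRGS-cong m (h-old a a<m) w)) ws)
            (sumMap-cong (λ w → trans (whenRGS-new m h w) (whenRGS-cong (suc m) h-new w)) ws)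
            (λ a m<a → trans (sumMap-cong (λ w → whenRGS-invalid m a h w m<a) ws) (sumMap-zero ws))
            K m<K)
    where ws = words K L

  swrec-from-old : ∀ i m a → a < m → ∀ w → swrec-from i m (suc a ∷ w) ≡ swrec-from (suc i) m w
  swrec-from-old i m a a<m w with m <ᵇ suc a in eq
  ... | true  = ⊥-elim (<⇒≱ a<m (≤-pred (<ᵇ⇒< m (suc a) (subst T (sym eq) tt))))
  ... | false = refl

  swrec-from-new : ∀ i m w → swrec-from i m (suc m ∷ w) ≡ i * suc m + swrec-from (suc i) (suc m) w
  swrec-from-new i m w with m <ᵇ suc m in eq
  ... | true  = refl
  ... | false = ⊥-elim (subst T eq (<⇒<ᵇ (n<1+n m)))

  -- The r-Bell numbers: rBell m L = L! [xᴸ] e^{mx} e^{eˣ-1}.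
  rBell : ℕ → ℕ → ℕ
  rBell m zero    = 1
  rBell m (suc L) = m * rBell m L + rBell (suc m) L

  -- xrBell m L = L! [xᴸ] x e^{mx} e^{eˣ-1} = L · rBell m (L ∸ 1).
  xrBell : ℕ → ℕ → ℕ
  xrBell m zero    = 0
  xrBell m (suc L) = rBell m L + m * xrBell m L + xrBell (suc m) L

  swrecSum : ℕ → ℕ → ℕ → ℕ
  swrecSum i m zero    = 0
  swrecSum i m (suc L) = m * swrecSum (suc i) m L + swrecSum (suc i) (suc m) L + i * suc m * rBell (suc m) L

  private
    first<bound : ∀ {m L K} → m + suc L ≤ K → m < K
    first<bound m+1+L≤K = <-≤-trans (m<m+n _ (s≤s z≤n)) m+1+L≤K

    old≤bound : ∀ {m L K} → m + suc L ≤ K → m + L ≤ K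
    old≤bound {m} {L} m+1+L≤K = ≤-trans (+-monoʳ-≤ m (n≤1+n L)) m+1+L≤K

    new≤bound : ∀ {m L K} → m + suc L ≤ K → suc m + L ≤ K
    new≤bound {m} {L} {K} = subst (_≤ K) (+-suc m L)

  -- The bound m + L ≤ K makes the alphabet {1, …, K} of words K L large enough for every continuation.
  sumMap-whenRGS-count : ∀ L K m → m + L ≤ K → sumMap (whenRGS m (const 1)) (words K L) ≡ rBell m L
  sumMap-whenRGS-count zero    K m _     = refl
  sumMap-whenRGS-count (suc L) K m bound =
    trans (sumMap-whenRGS-firstLetter {L = L} (const 1) (const 1) (const 1) (first<bound bound)
            (λ _ _ _ → refl) (λ _ → refl))
          (cong₂ (λ u v → m * u + v) (sumMap-whenRGS-count L K m (old≤bound bound))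
                                     (sumMap-whenRGS-count L K (suc m) (new≤bound bound)))

  sumMap-whenRGS-swrec : ∀ L K i m → m + L ≤ K →
                         sumMap (whenRGS m (swrec-from i m)) (words K L) ≡ swrecSum i m L
  sumMap-whenRGS-swrec zero    K i m _     = refl
  sumMap-whenRGS-swrec (suc L) K i m bound = begin
    sumMap (whenRGS m (swrec-from i m)) (words K (suc L))
      ≡⟨ sumMap-whenRGS-firstLetter {L = L} (swrec-from i m) old new (first<bound bound)
           (swrec-from-old i m) (swrec-from-new i m) ⟩
    m * sumMap (whenRGS m old) ws + sumMap (whenRGS (suc m) new) ws
      ≡⟨ cong (m * sumMap (whenRGS m old) ws +_)
              (sumMap-whenRGS-+ (suc m) c (swrec-from (suc i) (suc m)) ws) ⟩
    m * sumMap (whenRGS m old) ws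
      + (c * sumMap (whenRGS (suc m) (const 1)) ws + sumMap (whenRGS (suc m) (swrec-from (suc i) (suc m))) ws)
      ≡⟨ cong₂ (λ u v → m * u + v)
              (sumMap-whenRGS-swrec L K (suc i) m (old≤bound bound))
              (cong₂ (λ u v → c * u + v) (sumMap-whenRGS-count L K (suc m) (new≤bound bound))
                                         (sumMap-whenRGS-swrec L K (suc i) (suc m) (new≤bound bound))) ⟩
    m * swrecSum (suc i) m L + (c * rBell (suc m) L + swrecSum (suc i) (suc m) L)
      ≡⟨ swap (m * swrecSum (suc i) m L) (c * rBell (suc m) L) (swrecSum (suc i) (suc m) L) ⟩
    swrecSum i m (suc L) ∎
    where
    open ≡-Reasoning
    ws = words K L
    c = i * suc m
    old = swrec-from (suc i) m
    new = λ w → c + swrec-from (suc i) (suc m) w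
    swap : ∀ x y z → x + (y + z) ≡ x + z + y
    swap = solve-∀

  totalSwrec≡swrecSum : ∀ n → totalSwrec n ≡ swrecSum 1 0 n
  totalSwrec≡swrecSum n =
    trans (sumMap-filter (rgs? 0) swrec (words n n)) (sumMap-whenRGS-swrec n n 1 0 ≤-refl)

  lowerTerms : ℕ → ℕ → ℕ → ℕ
  lowerTerms i m L =
    (3 * m + 4 * m * m + 2 * i + 4 * i * m) * rBell m L + (2 * m + 4 * m * m) * xrBell m L
    + (7 + 4 * m) * rBell (suc m) L + (6 + 8 * m) * xrBell (suc m) L + 4 * xrBell (2 + m) L

  upperTerms : ℕ → ℕ → ℕ → ℕ
  upperTerms i m L =
    (4 * m * m + 4 * i * m) * rBell (suc m) L + (4 + 7 * m + 2 * i) * rBell (2 + m) L + 3 * rBell (3 + m) L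

  -- 4 · swrecSum i m L = upperTerms i m L - lowerTerms i m L, stated additively since subtraction on ℕ
  -- truncates.
  swrecSum-closedForm : ∀ L i m → 4 * swrecSum i m L + lowerTerms i m L ≡ upperTerms i m L
  swrecSum-closedForm zero    i m = base i m
    where
    base : ∀ i m →
      4 * 0 + ((3 * m + 4 * m * m + 2 * i + 4 * i * m) * 1 + (2 * m + 4 * m * m) * 0
               + (7 + 4 * m) * 1 + (6 + 8 * m) * 0 + 4 * 0)
      ≡ (4 * m * m + 4 * i * m) * 1 + (4 + 7 * m + 2 * i) * 1 + 3 * 1
    base = solve-∀
  swrecSum-closedForm (suc L) i m = +-cancelʳ-≡ _ _ _ (begin
    4 * (m * s₁ + s₂ + t) + lowerTerms i m (suc L) + (m * r₁ + r₂)
      ≡⟨ regroup m s₁ s₂ t (lowerTerms i m (suc L)) r₁ r₂ ⟩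
    m * (4 * s₁ + r₁) + (4 * s₂ + r₂) + (4 * t + lowerTerms i m (suc L))
      ≡⟨ cong₂ (λ u v → m * u + v + (4 * t + lowerTerms i m (suc L)))
               (swrecSum-closedForm L (suc i) m) (swrecSum-closedForm L (suc i) (suc m)) ⟩
    m * upperTerms (suc i) m L + upperTerms (suc i) (suc m) L + (4 * t + lowerTerms i m (suc L))
      ≡⟨ step i m (rBell m L) (rBell (1 + m) L) (rBell (2 + m) L) (rBell (3 + m) L) (rBell (4 + m) L)
                  (xrBell m L) (xrBell (1 + m) L) (xrBell (2 + m) L) (xrBell (3 + m) L) ⟩
    upperTerms i m (suc L) + (m * r₁ + r₂) ∎)
    where
    open ≡-Reasoning
    s₁ = swrecSum (suc i) m L
    s₂ = swrecSum (suc i) (suc m) L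
    t  = i * suc m * rBell (suc m) L
    r₁ = lowerTerms (suc i) m L
    r₂ = lowerTerms (suc i) (suc m) L
    regroup : ∀ m s₁ s₂ t u r₁ r₂ →
      4 * (m * s₁ + s₂ + t) + u + (m * r₁ + r₂) ≡ m * (4 * s₁ + r₁) + (4 * s₂ + r₂) + (4 * t + u)
    regroup = solve-∀
    -- lowerTerms and upperTerms with the values of rBell and xrBell at L abstracted as variables,
    -- so that the ring solver applies; their values at L + 1 are expanded by the recurrences.
    step : ∀ i m c₀ c₁ c₂ c₃ c₄ x₀ x₁ x₂ x₃ →
      let lower = λ i m c₀ c₁ x₀ x₁ x₂ →
                  (3 * m + 4 * m * m + 2 * i + 4 * i * m) * c₀ + (2 * m + 4 * m * m) * x₀
                  + (7 + 4 * m) * c₁ + (6 + 8 * m) * x₁ + 4 * x₂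
          upper = λ i m c₁ c₂ c₃ →
                  (4 * m * m + 4 * i * m) * c₁ + (4 + 7 * m + 2 * i) * c₂ + 3 * c₃
      in
      m * upper (suc i) m c₁ c₂ c₃ + upper (suc i) (suc m) c₂ c₃ c₄
        + (4 * (i * suc m * c₁) + lower i m (m * c₀ + c₁) (suc m * c₁ + c₂)
             (c₀ + m * x₀ + x₁) (c₁ + suc m * x₁ + x₂) (c₂ + (2 + m) * x₂ + x₃))
      ≡ upper i m (suc m * c₁ + c₂) ((2 + m) * c₂ + c₃) ((3 + m) * c₃ + c₄)
        + (m * lower (suc i) m c₀ c₁ x₀ x₁ x₂ + lower (suc i) (suc m) c₁ c₂ x₁ x₂ x₃)
    step = solve-∀

  swrecSum-closedForm₁₀ : ∀ n →
    2 * rBell 0 n + 7 * rBell 1 n + 6 * xrBell 1 n + 4 * xrBell 2 n + 4 * swrecSum 1 0 n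
      ≡ 6 * rBell 2 n + 3 * rBell 3 n
  swrecSum-closedForm₁₀ n =
    trans (reorder (swrecSum 1 0 n) (rBell 0 n) (rBell 1 n) (xrBell 1 n) (xrBell 2 n)) (swrecSum-closedForm n 1 0)
    where
    reorder : ∀ s b₀ b₁ x₁ x₂ →
      2 * b₀ + 7 * b₁ + 6 * x₁ + 4 * x₂ + 4 * s ≡ 4 * s + (2 * b₀ + 0 + 7 * b₁ + 6 * x₁ + 4 * x₂)
    reorder = solve-∀

open RestrictedGrowth using (rBell; xrBell; swrecSum; totalSwrec≡swrecSum; swrecSum-closedForm₁₀)

-- Rational arithmetic

open import Data.Nat as ℕ using (zero; suc; _∸_; _≤_; _<_; s≤s; z≤n; _!)
import Data.Nat.Properties as ℕ
import Data.Integer as ℤ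
import Data.Integer.Properties as ℤ
open import Data.Rational using (ℚ; 0ℚ; 1ℚ; _+_; _*_; -_; _/_; toℚᵘ)
open import Data.Rational.Properties
  using (_≟_; +-*-commutativeRing; toℚᵘ-injective; toℚᵘ-homo-+; toℚᵘ-homo-*; toℚᵘ-fromℚᵘ;
         +-assoc; +-comm; +-identityˡ; +-identityʳ; *-assoc; *-comm; *-identityˡ; *-identityʳ;
         *-zeroˡ; *-zeroʳ; *-distribˡ-+; *-distribʳ-+)
import Data.Rational.Unnormalised as ℚᵘ
import Data.Rational.Unnormalised.Properties as ℚᵘ
open import Data.List using (map; upTo; applyUpTo; _∷_; [])
open import Level using (0ℓ)
open import Relation.Nullary.Decidable using (dec⇒maybe)
open import Relation.Binary.PropositionalEquality
  using (_≗_; refl; sym; trans; cong; cong₂; module ≡-Reasoning)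
open import Tactic.RingSolver using (solve-∀; solve)
import Tactic.RingSolver.Core.AlmostCommutativeRing as ACR

ℚ-ring : ACR.AlmostCommutativeRing 0ℓ 0ℓ
ℚ-ring = ACR.fromCommutativeRing +-*-commutativeRing (λ x → dec⇒maybe (0ℚ ≟ x))

private
  toℚᵘ-fromℕℚ : ∀ a → toℚᵘ (fromℕℚ a) ℚᵘ.≃ ℚᵘ.mkℚᵘ (ℤ.+ a) 0
  toℚᵘ-fromℕℚ a = toℚᵘ-fromℚᵘ (ℚᵘ.mkℚᵘ (ℤ.+ a) 0)

fromℕℚ-homo-+ : ∀ a b → fromℕℚ (a ℕ.+ b) ≡ fromℕℚ a + fromℕℚ b
fromℕℚ-homo-+ a b = toℚᵘ-injective (begin
  toℚᵘ (fromℕℚ (a ℕ.+ b))                      ≈⟨ toℚᵘ-fromℕℚ (a ℕ.+ b) ⟩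
  ℚᵘ.mkℚᵘ (ℤ.+ (a ℕ.+ b)) 0                    ≈⟨ ℚᵘ.*≡* cross ⟩
  ℚᵘ.mkℚᵘ (ℤ.+ a) 0 ℚᵘ.+ ℚᵘ.mkℚᵘ (ℤ.+ b) 0     ≈⟨ ℚᵘ.+-cong (toℚᵘ-fromℕℚ a) (toℚᵘ-fromℕℚ b) ⟨
  toℚᵘ (fromℕℚ a) ℚᵘ.+ toℚᵘ (fromℕℚ b)         ≈⟨ toℚᵘ-homo-+ (fromℕℚ a) (fromℕℚ b) ⟨
  toℚᵘ (fromℕℚ a + fromℕℚ b)                   ∎)
  where
  open ℚᵘ.≃-Reasoning
  cross : ℤ.+ (a ℕ.+ b) ℤ.* ℤ.+ 1 ≡ (ℤ.+ a ℤ.* ℤ.+ 1 ℤ.+ ℤ.+ b ℤ.* ℤ.+ 1) ℤ.* ℤ.+ 1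
  cross rewrite ℤ.*-identityʳ (ℤ.+ (a ℕ.+ b)) | ℤ.*-identityʳ (ℤ.+ a) | ℤ.*-identityʳ (ℤ.+ b)
              | ℤ.*-identityʳ (ℤ.+ a ℤ.+ ℤ.+ b) = ℤ.pos-+ a b

fromℕℚ-homo-* : ∀ a b → fromℕℚ (a ℕ.* b) ≡ fromℕℚ a * fromℕℚ b
fromℕℚ-homo-* a b = toℚᵘ-injective (begin
  toℚᵘ (fromℕℚ (a ℕ.* b))                      ≈⟨ toℚᵘ-fromℕℚ (a ℕ.* b) ⟩
  ℚᵘ.mkℚᵘ (ℤ.+ (a ℕ.* b)) 0                    ≈⟨ ℚᵘ.*≡* cross ⟩
  ℚᵘ.mkℚᵘ (ℤ.+ a) 0 ℚᵘ.* ℚᵘ.mkℚᵘ (ℤ.+ b) 0     ≈⟨ ℚᵘ.*-cong (toℚᵘ-fromℕℚ a) (toℚᵘ-fromℕℚ b) ⟨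
  toℚᵘ (fromℕℚ a) ℚᵘ.* toℚᵘ (fromℕℚ b)         ≈⟨ toℚᵘ-homo-* (fromℕℚ a) (fromℕℚ b) ⟨
  toℚᵘ (fromℕℚ a * fromℕℚ b)                   ∎)
  where
  open ℚᵘ.≃-Reasoning
  cross : ℤ.+ (a ℕ.* b) ℤ.* ℤ.+ 1 ≡ (ℤ.+ a ℤ.* ℤ.+ b) ℤ.* ℤ.+ 1
  cross rewrite ℤ.*-identityʳ (ℤ.+ (a ℕ.* b)) | ℤ.*-identityʳ (ℤ.+ a ℤ.* ℤ.+ b) = ℤ.pos-* a b

1/n*n≡1 : ∀ n .{{_ : ℕ.NonZero n}} → (ℤ.+ 1 / n) * fromℕℚ n ≡ 1ℚ
1/n*n≡1 (suc n) = toℚᵘ-injective (begin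
  toℚᵘ ((ℤ.+ 1 / suc n) * fromℕℚ (suc n))               ≈⟨ toℚᵘ-homo-* (ℤ.+ 1 / suc n) (fromℕℚ (suc n)) ⟩
  toℚᵘ (ℤ.+ 1 / suc n) ℚᵘ.* toℚᵘ (fromℕℚ (suc n))       ≈⟨ ℚᵘ.*-cong (toℚᵘ-fromℚᵘ (ℚᵘ.mkℚᵘ (ℤ.+ 1) n))
                                                                    (toℚᵘ-fromℕℚ (suc n)) ⟩
  ℚᵘ.mkℚᵘ (ℤ.+ 1) n ℚᵘ.* ℚᵘ.mkℚᵘ (ℤ.+ suc n) 0          ≈⟨ ℚᵘ.*≡* cross ⟩
  toℚᵘ 1ℚ                                               ∎)
  where
  open ℚᵘ.≃-Reasoning
  cross : (ℤ.+ 1 ℤ.* ℤ.+ suc n) ℤ.* ℤ.+ 1 ≡ ℤ.+ 1 ℤ.* ℤ.+ (suc n ℕ.* 1)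
  cross = cong (λ k → ℤ.+ suc k) (trans (ℕ.*-identityʳ (n ℕ.+ 0)) (cong (ℕ._+ 0) (sym (ℕ.*-identityʳ n))))

*-cancelˡ-fromℕℚ-suc : ∀ n {x y} → fromℕℚ (suc n) * x ≡ fromℕℚ (suc n) * y → x ≡ y
*-cancelˡ-fromℕℚ-suc n {x} {y} eq = begin
  x                  ≡⟨ sym (*-identityˡ x) ⟩
  1ℚ * x             ≡⟨ cong (_* x) (sym (1/n*n≡1 (suc n))) ⟩
  (r * s) * x        ≡⟨ *-assoc r s x ⟩
  r * (s * x)        ≡⟨ cong (r *_) eq ⟩
  r * (s * y)        ≡⟨ sym (*-assoc r s y) ⟩
  (r * s) * y        ≡⟨ cong (_* y) (1/n*n≡1 (suc n)) ⟩
  1ℚ * y             ≡⟨ *-identityˡ y ⟩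
  y                  ∎
  where
  open ≡-Reasoning
  r = ℤ.+ 1 / suc n
  s = fromℕℚ (suc n)

invFact*! : ∀ n → invFact n * fromℕℚ (n !) ≡ 1ℚ
invFact*! n = 1/n*n≡1 (n !) {{n ℕ.!≢0}}

fromℕℚ-suc*invFact-suc : ∀ n → fromℕℚ (suc n) * invFact (suc n) ≡ invFact n
fromℕℚ-suc*invFact-suc n = begin
  s * a                  ≡⟨ sym (*-identityʳ (s * a)) ⟩
  s * a * 1ℚ             ≡⟨ cong (s * a *_) (sym (trans (*-comm f b) (invFact*! n))) ⟩
  s * a * (f * b)        ≡⟨ rearrange s a f b ⟩
  a * (s * f) * b        ≡⟨ cong (λ t → a * t * b) (sym (fromℕℚ-homo-* (suc n) (n !))) ⟩
  a * fromℕℚ (suc n !) * b ≡⟨ cong (_* b) (invFact*! (suc n)) ⟩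
  1ℚ * b                 ≡⟨ *-identityˡ b ⟩
  b                      ∎
  where
  open ≡-Reasoning
  s = fromℕℚ (suc n)
  a = invFact (suc n)
  f = fromℕℚ (n !)
  b = invFact n
  rearrange : ∀ s a f b → s * a * (f * b) ≡ a * (s * f) * b
  rearrange = solve-∀ ℚ-ring

-- Formal power series

sumBelow : ℕ → (ℕ → ℚ) → ℚ
sumBelow zero    f = 0ℚ
sumBelow (suc n) f = f 0 + sumBelow n (λ i → f (suc i))

sumℚ-map-upTo : ∀ n (f : ℕ → ℚ) → sumℚ (map f (upTo n)) ≡ sumBelow n f
sumℚ-map-upTo n f = go n (λ i → i)
  where
  go : ∀ n (g : ℕ → ℕ) → sumℚ (map f (applyUpTo g n)) ≡ sumBelow n (λ i → f (g i))
  go zero    g = refl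
  go (suc n) g = cong (f (g 0) +_) (go n (λ i → g (suc i)))

sumBelow-cong : ∀ n {f g : ℕ → ℚ} → (∀ i → i < n → f i ≡ g i) → sumBelow n f ≡ sumBelow n g
sumBelow-cong zero    f≡g = refl
sumBelow-cong (suc n) f≡g =
  cong₂ _+_ (f≡g 0 (s≤s z≤n)) (sumBelow-cong n (λ i i<n → f≡g (suc i) (s≤s i<n)))

sumBelow-+ : ∀ n (f g : ℕ → ℚ) → sumBelow n (λ i → f i + g i) ≡ sumBelow n f + sumBelow n g
sumBelow-+ zero    f g = refl
sumBelow-+ (suc n) f g = trans (cong (f 0 + g 0 +_) (sumBelow-+ n _ _)) (interchange (f 0) (g 0) _ _)
  where
  interchange : ∀ a b c d → a + b + (c + d) ≡ a + c + (b + d)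
  interchange = solve-∀ ℚ-ring

sumBelow-*ˡ : ∀ n c (f : ℕ → ℚ) → sumBelow n (λ i → c * f i) ≡ c * sumBelow n f
sumBelow-*ˡ zero    c f = sym (*-zeroʳ c)
sumBelow-*ˡ (suc n) c f = trans (cong (c * f 0 +_) (sumBelow-*ˡ n c _)) (sym (*-distribˡ-+ c (f 0) _))

sumBelow-zero : ∀ n → sumBelow n (λ _ → 0ℚ) ≡ 0ℚ
sumBelow-zero zero    = refl
sumBelow-zero (suc n) = trans (+-identityˡ _) (sumBelow-zero n)

sumBelow-suc : ∀ n (f : ℕ → ℚ) → sumBelow (suc n) f ≡ sumBelow n f + f n
sumBelow-suc zero    f = +-comm (f 0) 0ℚ
sumBelow-suc (suc n) f = trans (cong (f 0 +_) (sumBelow-suc n (λ i → f (suc i)))) (sym (+-assoc (f 0) _ _))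

⊛-coeff : ∀ f g n → (f ⊛ g) n ≡ sumBelow (suc n) (λ i → f i * g (n ∸ i))
⊛-coeff f g n = sumℚ-map-upTo (suc n) (λ i → f i * g (n ∸ i))

⊛-cong-≤ : ∀ n {f f′ g g′ : Series} →
           (∀ i → i ≤ n → f i ≡ f′ i) → (∀ i → i ≤ n → g i ≡ g′ i) → (f ⊛ g) n ≡ (f′ ⊛ g′) n
⊛-cong-≤ n {f} {f′} {g} {g′} f≡f′ g≡g′ = begin
  (f ⊛ g) n                                      ≡⟨ ⊛-coeff f g n ⟩
  sumBelow (suc n) (λ i → f i * g (n ∸ i))       ≡⟨ sumBelow-cong (suc n) termwise ⟩
  sumBelow (suc n) (λ i → f′ i * g′ (n ∸ i))     ≡⟨ ⊛-coeff f′ g′ n ⟨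
  (f′ ⊛ g′) n                                    ∎
  where
  open ≡-Reasoning
  termwise : ∀ i → i < suc n → f i * g (n ∸ i) ≡ f′ i * g′ (n ∸ i)
  termwise i i≤n = cong₂ _*_ (f≡f′ i (ℕ.≤-pred i≤n)) (g≡g′ (n ∸ i) (ℕ.m∸n≤m n i))

⊛-congˡ : ∀ {f f′} g → f ≗ f′ → f ⊛ g ≗ f′ ⊛ g
⊛-congˡ {f} {f′} g f≗f′ n = ⊛-cong-≤ n {f} {f′} {g} {g} (λ i _ → f≗f′ i) (λ _ _ → refl)

⊛-congʳ : ∀ f {g g′} → g ≗ g′ → f ⊛ g ≗ f ⊛ g′
⊛-congʳ f {g} {g′} g≗g′ n = ⊛-cong-≤ n {f} {f} {g} {g′} (λ _ _ → refl) (λ i _ → g≗g′ i)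

⊛-distribˡ-⊕ : ∀ f g h → f ⊛ (g ⊕ h) ≗ (f ⊛ g) ⊕ (f ⊛ h)
⊛-distribˡ-⊕ f g h n = begin
  (f ⊛ (g ⊕ h)) n
    ≡⟨ ⊛-coeff f (g ⊕ h) n ⟩
  sumBelow (suc n) (λ i → f i * (g (n ∸ i) + h (n ∸ i)))
    ≡⟨ sumBelow-cong (suc n) (λ i _ → *-distribˡ-+ (f i) (g (n ∸ i)) (h (n ∸ i))) ⟩
  sumBelow (suc n) (λ i → f i * g (n ∸ i) + f i * h (n ∸ i))
    ≡⟨ sumBelow-+ (suc n) (λ i → f i * g (n ∸ i)) (λ i → f i * h (n ∸ i)) ⟩
  sumBelow (suc n) (λ i → f i * g (n ∸ i)) + sumBelow (suc n) (λ i → f i * h (n ∸ i))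
    ≡⟨ cong₂ _+_ (⊛-coeff f g n) (⊛-coeff f h n) ⟨
  (f ⊛ g) n + (f ⊛ h) n ∎
  where open ≡-Reasoning

⊛-distribʳ-⊕ : ∀ f g h → (g ⊕ h) ⊛ f ≗ (g ⊛ f) ⊕ (h ⊛ f)
⊛-distribʳ-⊕ f g h n = begin
  ((g ⊕ h) ⊛ f) n
    ≡⟨ ⊛-coeff (g ⊕ h) f n ⟩
  sumBelow (suc n) (λ i → (g i + h i) * f (n ∸ i))
    ≡⟨ sumBelow-cong (suc n) (λ i _ → *-distribʳ-+ (f (n ∸ i)) (g i) (h i)) ⟩
  sumBelow (suc n) (λ i → g i * f (n ∸ i) + h i * f (n ∸ i))
    ≡⟨ sumBelow-+ (suc n) (λ i → g i * f (n ∸ i)) (λ i → h i * f (n ∸ i)) ⟩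
  sumBelow (suc n) (λ i → g i * f (n ∸ i)) + sumBelow (suc n) (λ i → h i * f (n ∸ i))
    ≡⟨ cong₂ _+_ (⊛-coeff g f n) (⊛-coeff h f n) ⟨
  (g ⊛ f) n + (h ⊛ f) n ∎
  where open ≡-Reasoning

⊛-scaleʳ : ∀ c f g → f ⊛ (c · g) ≗ c · (f ⊛ g)
⊛-scaleʳ c f g n = begin
  (f ⊛ (c · g)) n
    ≡⟨ ⊛-coeff f (c · g) n ⟩
  sumBelow (suc n) (λ i → f i * (c * g (n ∸ i)))
    ≡⟨ sumBelow-cong (suc n) (λ i _ → swap (f i) c (g (n ∸ i))) ⟩
  sumBelow (suc n) (λ i → c * (f i * g (n ∸ i)))
    ≡⟨ sumBelow-*ˡ (suc n) c (λ i → f i * g (n ∸ i)) ⟩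
  c * sumBelow (suc n) (λ i → f i * g (n ∸ i))
    ≡⟨ cong (c *_) (⊛-coeff f g n) ⟨
  c * (f ⊛ g) n ∎
  where
  open ≡-Reasoning
  swap : ∀ a c b → a * (c * b) ≡ c * (a * b)
  swap = solve-∀ ℚ-ring

⊛-scaleˡ : ∀ c f g → (c · f) ⊛ g ≗ c · (f ⊛ g)
⊛-scaleˡ c f g n = begin
  ((c · f) ⊛ g) n
    ≡⟨ ⊛-coeff (c · f) g n ⟩
  sumBelow (suc n) (λ i → c * f i * g (n ∸ i))
    ≡⟨ sumBelow-cong (suc n) (λ i _ → *-assoc c (f i) (g (n ∸ i))) ⟩
  sumBelow (suc n) (λ i → c * (f i * g (n ∸ i)))
    ≡⟨ sumBelow-*ˡ (suc n) c (λ i → f i * g (n ∸ i)) ⟩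
  c * sumBelow (suc n) (λ i → f i * g (n ∸ i))
    ≡⟨ cong (c *_) (⊛-coeff f g n) ⟨
  c * (f ⊛ g) n ∎
  where open ≡-Reasoning

⊛-zeroʳ : ∀ f → f ⊛ (λ _ → 0ℚ) ≗ (λ _ → 0ℚ)
⊛-zeroʳ f n = begin
  (f ⊛ (λ _ → 0ℚ)) n                ≡⟨ ⊛-coeff f _ n ⟩
  sumBelow (suc n) (λ i → f i * 0ℚ) ≡⟨ sumBelow-cong (suc n) (λ i _ → *-zeroʳ (f i)) ⟩
  sumBelow (suc n) (λ _ → 0ℚ)       ≡⟨ sumBelow-zero (suc n) ⟩
  0ℚ                                ∎
  where open ≡-Reasoning

⊛-identityˡ : ∀ f → oneS ⊛ f ≗ f
⊛-identityˡ f n = begin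
  (oneS ⊛ f) n                                              ≡⟨ ⊛-coeff oneS f n ⟩
  1ℚ * f n + sumBelow n (λ i → 0ℚ * f (n ∸ suc i))         ≡⟨ cong₂ _+_ (*-identityˡ (f n)) vanish ⟩
  f n + 0ℚ                                                  ≡⟨ +-identityʳ (f n) ⟩
  f n                                                       ∎
  where
  open ≡-Reasoning
  vanish : sumBelow n (λ i → 0ℚ * f (n ∸ suc i)) ≡ 0ℚ
  vanish = trans (sumBelow-cong n (λ i _ → *-zeroˡ (f (n ∸ suc i)))) (sumBelow-zero n)

∂ : Series → Series
∂ f n = fromℕℚ (suc n) * f (suc n)

∂-cancel : ∀ {f g} n → ∂ f n ≡ ∂ g n → f (suc n) ≡ g (suc n)
∂-cancel n = *-cancelˡ-fromℕℚ-suc n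

∂⊛-coeff : ∀ f g n → (∂ f ⊛ g) n ≡ sumBelow (2 ℕ.+ n) (λ i → fromℕℚ i * f i * g (suc n ∸ i))
∂⊛-coeff f g n = begin
  (∂ f ⊛ g) n
    ≡⟨ ⊛-coeff (∂ f) g n ⟩
  sumBelow (suc n) (λ i → fromℕℚ (suc i) * f (suc i) * g (n ∸ i))
    ≡⟨ +-identityˡ _ ⟨
  0ℚ + sumBelow (suc n) (λ i → fromℕℚ (suc i) * f (suc i) * g (n ∸ i))
    ≡⟨ cong (_+ sumBelow (suc n) (λ i → fromℕℚ (suc i) * f (suc i) * g (n ∸ i)))
            (sym (trans (cong (_* g (suc n)) (*-zeroˡ (f 0))) (*-zeroˡ (g (suc n))))) ⟩
  0ℚ * f 0 * g (suc n) + sumBelow (suc n) (λ i → fromℕℚ (suc i) * f (suc i) * g (n ∸ i)) ∎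
  where open ≡-Reasoning

⊛∂-coeff : ∀ f g n →
           (f ⊛ ∂ g) n ≡ sumBelow (2 ℕ.+ n) (λ i → f i * (fromℕℚ (suc n ∸ i) * g (suc n ∸ i)))
⊛∂-coeff f g n = begin
  (f ⊛ ∂ g) n
    ≡⟨ ⊛-coeff f (∂ g) n ⟩
  sumBelow (suc n) (λ i → f i * ∂ g (n ∸ i))
    ≡⟨ +-identityʳ _ ⟨
  sumBelow (suc n) (λ i → f i * ∂ g (n ∸ i)) + 0ℚ
    ≡⟨ cong₂ _+_ (sumBelow-cong (suc n) (λ i i≤n → cong (λ k → f i * (fromℕℚ k * g k))
                                                        (sym (ℕ.+-∸-assoc 1 (ℕ.≤-pred i≤n)))))
                 (sym lastVanishes) ⟩
  sumBelow (suc n) (λ i → term i) + term (suc n)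
    ≡⟨ sumBelow-suc (suc n) term ⟨
  sumBelow (2 ℕ.+ n) term ∎
  where
  open ≡-Reasoning
  term : ℕ → ℚ
  term i = f i * (fromℕℚ (suc n ∸ i) * g (suc n ∸ i))
  lastVanishes : term (suc n) ≡ 0ℚ
  lastVanishes rewrite ℕ.n∸n≡0 n = trans (cong (f (suc n) *_) (*-zeroˡ (g 0))) (*-zeroʳ (f (suc n)))

∂-⊛ : ∀ f g → ∂ (f ⊛ g) ≗ (∂ f ⊛ g) ⊕ (f ⊛ ∂ g)
∂-⊛ f g n = begin
  s * (f ⊛ g) (suc n)
    ≡⟨ cong (s *_) (⊛-coeff f g (suc n)) ⟩
  s * sumBelow (2 ℕ.+ n) (λ i → f i * g (suc n ∸ i))
    ≡⟨ sumBelow-*ˡ (2 ℕ.+ n) s (λ i → f i * g (suc n ∸ i)) ⟨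
  sumBelow (2 ℕ.+ n) (λ i → s * (f i * g (suc n ∸ i)))
    ≡⟨ sumBelow-cong (2 ℕ.+ n) split ⟩
  sumBelow (2 ℕ.+ n) (λ i → left i + right i)
    ≡⟨ sumBelow-+ (2 ℕ.+ n) left right ⟩
  sumBelow (2 ℕ.+ n) left + sumBelow (2 ℕ.+ n) right
    ≡⟨ cong₂ _+_ (∂⊛-coeff f g n) (⊛∂-coeff f g n) ⟨
  (∂ f ⊛ g) n + (f ⊛ ∂ g) n ∎
  where
  open ≡-Reasoning
  s = fromℕℚ (suc n)
  left right : ℕ → ℚ
  left  i = fromℕℚ i * f i * g (suc n ∸ i)
  right i = f i * (fromℕℚ (suc n ∸ i) * g (suc n ∸ i))
  distribute : ∀ a b x y → (a + b) * (x * y) ≡ a * x * y + x * (b * y)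
  distribute = solve-∀ ℚ-ring
  split : ∀ i → i < 2 ℕ.+ n → s * (f i * g (suc n ∸ i)) ≡ left i + right i
  split i i≤1+n = begin
    s * (f i * g (suc n ∸ i))
      ≡⟨ cong (λ k → fromℕℚ k * (f i * g (suc n ∸ i))) (sym (ℕ.m+[n∸m]≡n (ℕ.≤-pred i≤1+n))) ⟩
    fromℕℚ (i ℕ.+ (suc n ∸ i)) * (f i * g (suc n ∸ i))
      ≡⟨ cong (_* (f i * g (suc n ∸ i))) (fromℕℚ-homo-+ i (suc n ∸ i)) ⟩
    (fromℕℚ i + fromℕℚ (suc n ∸ i)) * (f i * g (suc n ∸ i))
      ≡⟨ distribute (fromℕℚ i) (fromℕℚ (suc n ∸ i)) (f i) (g (suc n ∸ i)) ⟩
    left i + right i ∎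

⊛-comm : ∀ f g → f ⊛ g ≗ g ⊛ f
⊛-comm f g zero    = cong (_+ 0ℚ) (*-comm (f 0) (g 0))
⊛-comm f g (suc n) = ∂-cancel {f ⊛ g} {g ⊛ f} n (begin
  ∂ (f ⊛ g) n                   ≡⟨ ∂-⊛ f g n ⟩
  (∂ f ⊛ g) n + (f ⊛ ∂ g) n     ≡⟨ cong₂ _+_ (⊛-comm (∂ f) g n) (⊛-comm f (∂ g) n) ⟩
  (g ⊛ ∂ f) n + (∂ g ⊛ f) n     ≡⟨ +-comm ((g ⊛ ∂ f) n) ((∂ g ⊛ f) n) ⟩
  (∂ g ⊛ f) n + (g ⊛ ∂ f) n     ≡⟨ ∂-⊛ g f n ⟨
  ∂ (g ⊛ f) n                   ∎)
  where open ≡-Reasoning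

⊛-assoc : ∀ f g h → (f ⊛ g) ⊛ h ≗ f ⊛ (g ⊛ h)
⊛-assoc f g h zero    = assoc₀ (f 0) (g 0) (h 0)
  where
  assoc₀ : ∀ a b c → (a * b + 0ℚ) * c + 0ℚ ≡ a * (b * c + 0ℚ) + 0ℚ
  assoc₀ = solve-∀ ℚ-ring
⊛-assoc f g h (suc n) = ∂-cancel {(f ⊛ g) ⊛ h} {f ⊛ (g ⊛ h)} n (begin
  ∂ ((f ⊛ g) ⊛ h) n
    ≡⟨ ∂-⊛ (f ⊛ g) h n ⟩
  (∂ (f ⊛ g) ⊛ h) n + ((f ⊛ g) ⊛ ∂ h) n
    ≡⟨ cong (_+ ((f ⊛ g) ⊛ ∂ h) n)
            (trans (⊛-congˡ h (∂-⊛ f g) n) (⊛-distribʳ-⊕ h (∂ f ⊛ g) (f ⊛ ∂ g) n)) ⟩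
  ((∂ f ⊛ g) ⊛ h) n + ((f ⊛ ∂ g) ⊛ h) n + ((f ⊛ g) ⊛ ∂ h) n
    ≡⟨ cong₂ _+_ (cong₂ _+_ (⊛-assoc (∂ f) g h n) (⊛-assoc f (∂ g) h n)) (⊛-assoc f g (∂ h) n) ⟩
  (∂ f ⊛ (g ⊛ h)) n + (f ⊛ (∂ g ⊛ h)) n + (f ⊛ (g ⊛ ∂ h)) n
    ≡⟨ +-assoc ((∂ f ⊛ (g ⊛ h)) n) _ _ ⟩
  (∂ f ⊛ (g ⊛ h)) n + ((f ⊛ (∂ g ⊛ h)) n + (f ⊛ (g ⊛ ∂ h)) n)
    ≡⟨ cong ((∂ f ⊛ (g ⊛ h)) n +_)
            (trans (⊛-congʳ f (∂-⊛ g h) n) (⊛-distribˡ-⊕ f (∂ g ⊛ h) (g ⊛ ∂ h) n)) ⟨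
  (∂ f ⊛ (g ⊛ h)) n + (f ⊛ ∂ (g ⊛ h)) n
    ≡⟨ ∂-⊛ f (g ⊛ h) n ⟨
  ∂ (f ⊛ (g ⊛ h)) n ∎)
  where open ≡-Reasoning

x⊛yz≗y⊛xz : ∀ f g h → f ⊛ (g ⊛ h) ≗ g ⊛ (f ⊛ h)
x⊛yz≗y⊛xz f g h n = begin
  (f ⊛ (g ⊛ h)) n  ≡⟨ ⊛-assoc f g h n ⟨
  ((f ⊛ g) ⊛ h) n  ≡⟨ ⊛-congˡ h (⊛-comm f g) n ⟩
  ((g ⊛ f) ⊛ h) n  ≡⟨ ⊛-assoc g f h n ⟩
  (g ⊛ (f ⊛ h)) n  ∎
  where open ≡-Reasoning

-- Exponentials

∂-oneS : ∂ oneS ≗ (λ _ → 0ℚ)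
∂-oneS n = *-zeroʳ (fromℕℚ (suc n))

∂-xS : ∂ xS ≗ oneS
∂-xS zero    = refl
∂-xS (suc n) = *-zeroʳ (fromℕℚ (2 ℕ.+ n))

∂-expLin : ∀ c → ∂ (expLin c) ≗ fromℕℚ c · expLin c
∂-expLin c n = begin
  s * (fromℕℚ (c ℕ.* c ℕ.^ n) * invFact (suc n))
    ≡⟨ cong (λ a → s * (a * invFact (suc n))) (fromℕℚ-homo-* c (c ℕ.^ n)) ⟩
  s * (fromℕℚ c * fromℕℚ (c ℕ.^ n) * invFact (suc n))
    ≡⟨ rearrange s (fromℕℚ c) (fromℕℚ (c ℕ.^ n)) (invFact (suc n)) ⟩
  fromℕℚ c * (fromℕℚ (c ℕ.^ n) * (s * invFact (suc n)))
    ≡⟨ cong (λ a → fromℕℚ c * (fromℕℚ (c ℕ.^ n) * a)) (fromℕℚ-suc*invFact-suc n) ⟩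
  fromℕℚ c * expLin c n ∎
  where
  open ≡-Reasoning
  s = fromℕℚ (suc n)
  rearrange : ∀ s a b i → s * (a * b * i) ≡ a * (b * (s * i))
  rearrange = solve-∀ ℚ-ring

expLin-+ : ∀ a b → expLin a ⊛ expLin b ≗ expLin (a ℕ.+ b)
expLin-+ a b zero    = refl
expLin-+ a b (suc n) = ∂-cancel {expLin a ⊛ expLin b} {expLin (a ℕ.+ b)} n (begin
  ∂ (expLin a ⊛ expLin b) n
    ≡⟨ ∂-⊛ (expLin a) (expLin b) n ⟩
  (∂ (expLin a) ⊛ expLin b) n + (expLin a ⊛ ∂ (expLin b)) n
    ≡⟨ cong₂ _+_ (⊛-congˡ (expLin b) (∂-expLin a) n) (⊛-congʳ (expLin a) (∂-expLin b) n) ⟩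
  ((fromℕℚ a · expLin a) ⊛ expLin b) n + (expLin a ⊛ (fromℕℚ b · expLin b)) n
    ≡⟨ cong₂ _+_ (⊛-scaleˡ (fromℕℚ a) (expLin a) (expLin b) n)
                 (⊛-scaleʳ (fromℕℚ b) (expLin a) (expLin b) n) ⟩
  fromℕℚ a * (expLin a ⊛ expLin b) n + fromℕℚ b * (expLin a ⊛ expLin b) n
    ≡⟨ *-distribʳ-+ ((expLin a ⊛ expLin b) n) (fromℕℚ a) (fromℕℚ b) ⟨
  (fromℕℚ a + fromℕℚ b) * (expLin a ⊛ expLin b) n
    ≡⟨ cong₂ _*_ (sym (fromℕℚ-homo-+ a b)) (expLin-+ a b n) ⟩
  fromℕℚ (a ℕ.+ b) * expLin (a ℕ.+ b) n
    ≡⟨ ∂-expLin (a ℕ.+ b) n ⟨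
  ∂ (expLin (a ℕ.+ b)) n ∎)
  where open ≡-Reasoning

powS-vanish : ∀ f → f 0 ≡ 0ℚ → ∀ k n → n < k → powS f k n ≡ 0ℚ
powS-vanish f f₀≡0 (suc k) n n<1+k = begin
  (f ⊛ powS f k) n
    ≡⟨ ⊛-coeff f (powS f k) n ⟩
  f 0 * powS f k n + sumBelow n (λ i → f (suc i) * powS f k (n ∸ suc i))
    ≡⟨ cong₂ _+_ (trans (cong (_* powS f k n) f₀≡0) (*-zeroˡ (powS f k n)))
                 (trans (sumBelow-cong n later) (sumBelow-zero n)) ⟩
  0ℚ + 0ℚ
    ≡⟨ +-identityˡ 0ℚ ⟩
  0ℚ ∎
  where
  open ≡-Reasoning
  later : ∀ i → i < n → f (suc i) * powS f k (n ∸ suc i) ≡ 0ℚ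
  later i i<n =
    trans (cong (f (suc i) *_) (powS-vanish f f₀≡0 k (n ∸ suc i) n∸1+i<k)) (*-zeroʳ (f (suc i)))
    where n∸1+i<k = ℕ.<-≤-trans (ℕ.∸-monoʳ-< {o = 0} (s≤s z≤n) i<n) (ℕ.≤-pred n<1+k)

∂-powS : ∀ f k → ∂ (powS f (suc k)) ≗ fromℕℚ (suc k) · (∂ f ⊛ powS f k)
∂-powS f k n = begin
  ∂ (f ⊛ powS f k) n                   ≡⟨ ∂-⊛ f (powS f k) n ⟩
  t + (f ⊛ ∂ (powS f k)) n             ≡⟨ cong (t +_) (later k) ⟩
  t + fromℕℚ k * t                     ≡⟨ cong (_+ fromℕℚ k * t) (*-identityˡ t) ⟨
  1ℚ * t + fromℕℚ k * t                ≡⟨ *-distribʳ-+ t 1ℚ (fromℕℚ k) ⟨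
  (1ℚ + fromℕℚ k) * t                  ≡⟨ cong (_* t) (fromℕℚ-homo-+ 1 k) ⟨
  fromℕℚ (suc k) * t                   ∎
  where
  open ≡-Reasoning
  t = (∂ f ⊛ powS f k) n
  later : ∀ k → (f ⊛ ∂ (powS f k)) n ≡ fromℕℚ k * (∂ f ⊛ powS f k) n
  later zero     = trans (⊛-congʳ f ∂-oneS n) (trans (⊛-zeroʳ f n) (sym (*-zeroˡ ((∂ f ⊛ powS f 0) n))))
  later (suc k′) = begin
    (f ⊛ ∂ (powS f (suc k′))) n
      ≡⟨ ⊛-congʳ f (∂-powS f k′) n ⟩
    (f ⊛ (fromℕℚ (suc k′) · (∂ f ⊛ powS f k′))) n
      ≡⟨ ⊛-scaleʳ (fromℕℚ (suc k′)) f (∂ f ⊛ powS f k′) n ⟩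
    fromℕℚ (suc k′) * (f ⊛ (∂ f ⊛ powS f k′)) n
      ≡⟨ cong (fromℕℚ (suc k′) *_) (x⊛yz≗y⊛xz f (∂ f) (powS f k′) n) ⟩
    fromℕℚ (suc k′) * (∂ f ⊛ powS f (suc k′)) n ∎

expPartial : Series → ℕ → Series
expPartial f N n = sumBelow N (λ k → powS f k n * invFact k)

expPartial-suc : ∀ f N n → expPartial f (suc N) n ≡ expPartial f N n + powS f N n * invFact N
expPartial-suc f N n = sumBelow-suc N (λ k → powS f k n * invFact k)

expComp≡expPartial : ∀ f n → expComp f n ≡ expPartial f (suc n) n
expComp≡expPartial f n = sumℚ-map-upTo (suc n) (λ k → powS f k n * invFact k)

expPartial-stable : ∀ f → f 0 ≡ 0ℚ → ∀ d n → expPartial f (suc (d ℕ.+ n)) n ≡ expComp f n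
expPartial-stable f f₀≡0 zero    n = sym (expComp≡expPartial f n)
expPartial-stable f f₀≡0 (suc d) n = begin
  expPartial f (2 ℕ.+ d ℕ.+ n) n
    ≡⟨ expPartial-suc f (suc (d ℕ.+ n)) n ⟩
  expPartial f (suc (d ℕ.+ n)) n + powS f (suc (d ℕ.+ n)) n * invFact (suc (d ℕ.+ n))
    ≡⟨ cong (λ a → expPartial f (suc (d ℕ.+ n)) n + a * invFact (suc (d ℕ.+ n)))
            (powS-vanish f f₀≡0 (suc (d ℕ.+ n)) n (s≤s (ℕ.m≤n+m n d))) ⟩
  expPartial f (suc (d ℕ.+ n)) n + 0ℚ * invFact (suc (d ℕ.+ n))
    ≡⟨ cong (expPartial f (suc (d ℕ.+ n)) n +_) (*-zeroˡ (invFact (suc (d ℕ.+ n)))) ⟩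
  expPartial f (suc (d ℕ.+ n)) n + 0ℚ
    ≡⟨ +-identityʳ (expPartial f (suc (d ℕ.+ n)) n) ⟩
  expPartial f (suc (d ℕ.+ n)) n
    ≡⟨ expPartial-stable f f₀≡0 d n ⟩
  expComp f n ∎
  where open ≡-Reasoning

∂-expPartial : ∀ f N → ∂ (expPartial f (suc N)) ≗ ∂ f ⊛ expPartial f N
∂-expPartial f zero n = begin
  s * (0ℚ * 1ℚ + 0ℚ)        ≡⟨ *-zeroʳ s ⟩
  0ℚ                        ≡⟨ ⊛-zeroʳ (∂ f) n ⟨
  (∂ f ⊛ expPartial f 0) n  ∎
  where
  open ≡-Reasoning
  s = fromℕℚ (suc n)
∂-expPartial f (suc N) n = begin
  s * expPartial f (2 ℕ.+ N) (suc n)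
    ≡⟨ cong (s *_) (expPartial-suc f (suc N) (suc n)) ⟩
  s * (expPartial f (suc N) (suc n) + powS f (suc N) (suc n) * invFact (suc N))
    ≡⟨ distribute s (expPartial f (suc N) (suc n)) (powS f (suc N) (suc n)) (invFact (suc N)) ⟩
  ∂ (expPartial f (suc N)) n + invFact (suc N) * ∂ (powS f (suc N)) n
    ≡⟨ cong₂ (λ a b → a + invFact (suc N) * b) (∂-expPartial f N n) (∂-powS f N n) ⟩
  (∂ f ⊛ expPartial f N) n + invFact (suc N) * (fromℕℚ (suc N) * (∂ f ⊛ powS f N) n)
    ≡⟨ cong ((∂ f ⊛ expPartial f N) n +_) (invFact-rescale ((∂ f ⊛ powS f N) n)) ⟩
  (∂ f ⊛ expPartial f N) n + invFact N * (∂ f ⊛ powS f N) n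
    ≡⟨ cong ((∂ f ⊛ expPartial f N) n +_) (⊛-scaleʳ (invFact N) (∂ f) (powS f N) n) ⟨
  (∂ f ⊛ expPartial f N) n + (∂ f ⊛ (invFact N · powS f N)) n
    ≡⟨ ⊛-distribˡ-⊕ (∂ f) (expPartial f N) (invFact N · powS f N) n ⟨
  (∂ f ⊛ (expPartial f N ⊕ (invFact N · powS f N))) n
    ≡⟨ ⊛-congʳ (∂ f) (λ i → trans (cong (expPartial f N i +_) (*-comm (invFact N) (powS f N i)))
                                  (sym (expPartial-suc f N i))) n ⟩
  (∂ f ⊛ expPartial f (suc N)) n ∎
  where
  open ≡-Reasoning
  s = fromℕℚ (suc n)
  distribute : ∀ s e p i → s * (e + p * i) ≡ s * e + i * (s * p)
  distribute = solve-∀ ℚ-ring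
  invFact-rescale : ∀ x → invFact (suc N) * (fromℕℚ (suc N) * x) ≡ invFact N * x
  invFact-rescale x = begin
    invFact (suc N) * (fromℕℚ (suc N) * x)  ≡⟨ *-assoc (invFact (suc N)) (fromℕℚ (suc N)) x ⟨
    invFact (suc N) * fromℕℚ (suc N) * x    ≡⟨ cong (_* x) (*-comm (invFact (suc N)) (fromℕℚ (suc N))) ⟩
    fromℕℚ (suc N) * invFact (suc N) * x    ≡⟨ cong (_* x) (fromℕℚ-suc*invFact-suc N) ⟩
    invFact N * x                           ∎

∂-expComp : ∀ f → f 0 ≡ 0ℚ → ∂ (expComp f) ≗ ∂ f ⊛ expComp f
∂-expComp f f₀≡0 n = begin
  ∂ (expComp f) n                    ≡⟨ cong (fromℕℚ (suc n) *_) (expComp≡expPartial f (suc n)) ⟩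
  ∂ (expPartial f (2 ℕ.+ n)) n       ≡⟨ ∂-expPartial f (suc n) n ⟩
  (∂ f ⊛ expPartial f (suc n)) n     ≡⟨ ⊛-cong-≤ n {∂ f} {∂ f} (λ _ _ → refl) agree ⟩
  (∂ f ⊛ expComp f) n                ∎
  where
  open ≡-Reasoning
  agree : ∀ i → i ≤ n → expPartial f (suc n) i ≡ expComp f i
  agree i i≤n =
    trans (cong (λ N → expPartial f (suc N) i) (sym (ℕ.m∸n+n≡m i≤n))) (expPartial-stable f f₀≡0 (n ∸ i) i)

-- Coefficients of both sides

_/!_ : ℕ → ℕ → ℚ
k /! n = fromℕℚ k * invFact n

/!-+ : ∀ a b n → (a ℕ.+ b) /! n ≡ a /! n + b /! n
/!-+ a b n =
  trans (cong (_* invFact n) (fromℕℚ-homo-+ a b)) (*-distribʳ-+ (invFact n) (fromℕℚ a) (fromℕℚ b))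

/!-* : ∀ a b n → (a ℕ.* b) /! n ≡ fromℕℚ a * (b /! n)
/!-* a b n = trans (cong (_* invFact n) (fromℕℚ-homo-* a b)) (*-assoc (fromℕℚ a) (fromℕℚ b) (invFact n))

coeff-suc-from-∂ : ∀ {f} n k → ∂ f n ≡ k /! n → f (suc n) ≡ k /! suc n
coeff-suc-from-∂ {f} n k ∂f≡k/!n = ∂-cancel {f} {λ m → k /! m} n (trans ∂f≡k/!n (sym rescale))
  where
  rescale : fromℕℚ (suc n) * (k /! suc n) ≡ k /! n
  rescale = begin
    fromℕℚ (suc n) * (fromℕℚ k * invFact (suc n))  ≡⟨ *-assoc (fromℕℚ (suc n)) (fromℕℚ k) _ ⟨
    fromℕℚ (suc n) * fromℕℚ k * invFact (suc n)    ≡⟨ cong (_* invFact (suc n)) (*-comm (fromℕℚ (suc n)) (fromℕℚ k)) ⟩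
    fromℕℚ k * fromℕℚ (suc n) * invFact (suc n)    ≡⟨ *-assoc (fromℕℚ k) (fromℕℚ (suc n)) _ ⟩
    fromℕℚ k * (fromℕℚ (suc n) * invFact (suc n))  ≡⟨ cong (fromℕℚ k *_) (fromℕℚ-suc*invFact-suc n) ⟩
    fromℕℚ k * invFact n                           ∎
    where open ≡-Reasoning

∂-expMinusOne : ∂ expMinusOne ≗ expLin 1
∂-expMinusOne n = begin
  s * (expLin 1 (suc n) + - 1ℚ * 0ℚ)   ≡⟨ cong (λ a → s * (expLin 1 (suc n) + a)) (*-zeroʳ (- 1ℚ)) ⟩
  s * (expLin 1 (suc n) + 0ℚ)          ≡⟨ cong (s *_) (+-identityʳ (expLin 1 (suc n))) ⟩
  ∂ (expLin 1) n                       ≡⟨ ∂-expLin 1 n ⟩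
  1ℚ * expLin 1 n                      ≡⟨ *-identityˡ (expLin 1 n) ⟩
  expLin 1 n                           ∎
  where
  open ≡-Reasoning
  s = fromℕℚ (suc n)

bell : Series
bell = expComp expMinusOne

∂-bell : ∂ bell ≗ expLin 1 ⊛ bell
∂-bell n = trans (∂-expComp expMinusOne refl n) (⊛-congˡ bell ∂-expMinusOne n)

∂-bell⊛expLin : ∀ j →
                ∂ (bell ⊛ expLin j) ≗ (fromℕℚ j · (bell ⊛ expLin j)) ⊕ (bell ⊛ expLin (suc j))
∂-bell⊛expLin j n = begin
  ∂ (bell ⊛ expLin j) n
    ≡⟨ ∂-⊛ bell (expLin j) n ⟩
  (∂ bell ⊛ expLin j) n + (bell ⊛ ∂ (expLin j)) n
    ≡⟨ cong₂ _+_ (⊛-congˡ (expLin j) ∂-bell n) (⊛-congʳ bell (∂-expLin j) n) ⟩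
  ((expLin 1 ⊛ bell) ⊛ expLin j) n + (bell ⊛ (fromℕℚ j · expLin j)) n
    ≡⟨ cong₂ _+_ (trans (⊛-assoc (expLin 1) bell (expLin j) n) (x⊛yz≗y⊛xz (expLin 1) bell (expLin j) n))
                 (⊛-scaleʳ (fromℕℚ j) bell (expLin j) n) ⟩
  (bell ⊛ (expLin 1 ⊛ expLin j)) n + fromℕℚ j * (bell ⊛ expLin j) n
    ≡⟨ cong (_+ fromℕℚ j * (bell ⊛ expLin j) n) (⊛-congʳ bell (expLin-+ 1 j) n) ⟩
  (bell ⊛ expLin (suc j)) n + fromℕℚ j * (bell ⊛ expLin j) n
    ≡⟨ +-comm ((bell ⊛ expLin (suc j)) n) _ ⟩
  fromℕℚ j * (bell ⊛ expLin j) n + (bell ⊛ expLin (suc j)) n ∎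
  where open ≡-Reasoning

bell⊛expLin-coeff : ∀ j n → (bell ⊛ expLin j) n ≡ rBell j n /! n
bell⊛expLin-coeff j zero    = refl
bell⊛expLin-coeff j (suc n) = coeff-suc-from-∂ {bell ⊛ expLin j} n (rBell j (suc n)) (begin
  ∂ (bell ⊛ expLin j) n
    ≡⟨ ∂-bell⊛expLin j n ⟩
  fromℕℚ j * (bell ⊛ expLin j) n + (bell ⊛ expLin (suc j)) n
    ≡⟨ cong₂ (λ a b → fromℕℚ j * a + b) (bell⊛expLin-coeff j n) (bell⊛expLin-coeff (suc j) n) ⟩
  fromℕℚ j * (rBell j n /! n) + rBell (suc j) n /! n
    ≡⟨ cong (_+ rBell (suc j) n /! n) (/!-* j (rBell j n) n) ⟨
  (j ℕ.* rBell j n) /! n + rBell (suc j) n /! n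
    ≡⟨ /!-+ (j ℕ.* rBell j n) (rBell (suc j) n) n ⟨
  rBell j (suc n) /! n ∎)
  where open ≡-Reasoning

∂-xS⊛ : ∀ f → ∂ (xS ⊛ f) ≗ f ⊕ (xS ⊛ ∂ f)
∂-xS⊛ f n =
  trans (∂-⊛ xS f n) (cong (_+ (xS ⊛ ∂ f) n) (trans (⊛-congˡ f ∂-xS n) (⊛-identityˡ f n)))

xS⊛bell⊛expLin-coeff : ∀ j n → (xS ⊛ (bell ⊛ expLin j)) n ≡ xrBell j n /! n
xS⊛bell⊛expLin-coeff j zero    = trans (+-identityʳ _) (*-zeroˡ ((bell ⊛ expLin j) 0))
xS⊛bell⊛expLin-coeff j (suc n) = coeff-suc-from-∂ {xS ⊛ (bell ⊛ expLin j)} n (xrBell j (suc n)) (begin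
  ∂ (xS ⊛ h j) n
    ≡⟨ ∂-xS⊛ (h j) n ⟩
  h j n + (xS ⊛ ∂ (h j)) n
    ≡⟨ cong (h j n +_) (trans (⊛-congʳ xS (∂-bell⊛expLin j) n)
                              (trans (⊛-distribˡ-⊕ xS (fromℕℚ j · h j) (h (suc j)) n)
                                     (cong (_+ (xS ⊛ h (suc j)) n) (⊛-scaleʳ (fromℕℚ j) xS (h j) n)))) ⟩
  h j n + (fromℕℚ j * (xS ⊛ h j) n + (xS ⊛ h (suc j)) n)
    ≡⟨ cong₂ (λ a b → a + (fromℕℚ j * b + (xS ⊛ h (suc j)) n))
             (bell⊛expLin-coeff j n) (xS⊛bell⊛expLin-coeff j n) ⟩
  rBell j n /! n + (fromℕℚ j * (xrBell j n /! n) + (xS ⊛ h (suc j)) n)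
    ≡⟨ cong (λ a → rBell j n /! n + (fromℕℚ j * (xrBell j n /! n) + a))
            (xS⊛bell⊛expLin-coeff (suc j) n) ⟩
  rBell j n /! n + (fromℕℚ j * (xrBell j n /! n) + xrBell (suc j) n /! n)
    ≡⟨ cong (λ a → rBell j n /! n + (a + xrBell (suc j) n /! n)) (/!-* j (xrBell j n) n) ⟨
  rBell j n /! n + ((j ℕ.* xrBell j n) /! n + xrBell (suc j) n /! n)
    ≡⟨ +-assoc (rBell j n /! n) _ _ ⟨
  rBell j n /! n + (j ℕ.* xrBell j n) /! n + xrBell (suc j) n /! n
    ≡⟨ cong (_+ xrBell (suc j) n /! n) (/!-+ (rBell j n) (j ℕ.* xrBell j n) n) ⟨
  (rBell j n ℕ.+ j ℕ.* xrBell j n) /! n + xrBell (suc j) n /! n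
    ≡⟨ /!-+ (rBell j n ℕ.+ j ℕ.* xrBell j n) (xrBell (suc j) n) n ⟨
  xrBell j (suc n) /! n ∎)
  where
  open ≡-Reasoning
  h : ℕ → Series
  h j = bell ⊛ expLin j

oneS≗expLin0 : oneS ≗ expLin 0
oneS≗expLin0 zero    = refl
oneS≗expLin0 (suc n) = sym (*-zeroˡ (invFact (suc n)))

rhsCoeff : ℕ → ℚ
rhsCoeff n = ℤ.+ 3 / 4 * (rBell 3 n /! n) + ℤ.+ 3 / 2 * (rBell 2 n /! n) + - (ℤ.+ 7 / 4) * (rBell 1 n /! n)
             + - 1ℚ * (xrBell 2 n /! n) + - (ℤ.+ 3 / 2) * (xrBell 1 n /! n) + - (ℤ.+ 1 / 2) * (rBell 0 n /! n)

rhsSeries-coeff : ∀ n → rhsSeries n ≡ rhsCoeff n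
rhsSeries-coeff n =
  split ((((t₃ ⊕ t₂) ⊕ t₁) ⊕ u₂) ⊕ u₁) t₀
    (split (((t₃ ⊕ t₂) ⊕ t₁) ⊕ u₂) u₁
      (split ((t₃ ⊕ t₂) ⊕ t₁) u₂
        (split (t₃ ⊕ t₂) t₁
          (split t₃ t₂ (exponential (ℤ.+ 3 / 4) 3) (exponential (ℤ.+ 3 / 2) 2))
          (exponential (- (ℤ.+ 7 / 4)) 1))
        (shiftedExponential (- 1ℚ) 2))
      (shiftedExponential (- (ℤ.+ 3 / 2)) 1))
    (constant (- (ℤ.+ 1 / 2)))
  where
  t₃ t₂ t₁ u₂ u₁ t₀ : Series
  t₃ = (ℤ.+ 3 / 4) · expLin 3
  t₂ = (ℤ.+ 3 / 2) · expLin 2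
  t₁ = (- (ℤ.+ 7 / 4)) · expLin 1
  u₂ = (- 1ℚ) · (xS ⊛ expLin 2)
  u₁ = (- (ℤ.+ 3 / 2)) · (xS ⊛ expLin 1)
  t₀ = (- (ℤ.+ 1 / 2)) · oneS
  split : ∀ g h {a b} → (bell ⊛ g) n ≡ a → (bell ⊛ h) n ≡ b → (bell ⊛ (g ⊕ h)) n ≡ a + b
  split g h p q = trans (⊛-distribˡ-⊕ bell g h n) (cong₂ _+_ p q)
  exponential : ∀ c j → (bell ⊛ (c · expLin j)) n ≡ c * (rBell j n /! n)
  exponential c j = trans (⊛-scaleʳ c bell (expLin j) n) (cong (c *_) (bell⊛expLin-coeff j n))
  shiftedExponential : ∀ c j → (bell ⊛ (c · (xS ⊛ expLin j))) n ≡ c * (xrBell j n /! n)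
  shiftedExponential c j = trans (⊛-scaleʳ c bell (xS ⊛ expLin j) n)
    (cong (c *_) (trans (x⊛yz≗y⊛xz bell xS (expLin j) n) (xS⊛bell⊛expLin-coeff j n)))
  constant : ∀ c → (bell ⊛ (c · oneS)) n ≡ c * (rBell 0 n /! n)
  constant c = trans (⊛-scaleʳ c bell oneS n)
    (cong (c *_) (trans (⊛-congʳ bell oneS≗expLin0 n) (bell⊛expLin-coeff 0 n)))

/!-+-* : ∀ a k b n → (a ℕ.+ k ℕ.* b) /! n ≡ a /! n + fromℕℚ k * (b /! n)
/!-+-* a k b n = trans (/!-+ a (k ℕ.* b) n) (cong (a /! n +_) (/!-* k b n))

isolate : ∀ s b₀ b₁ b₂ b₃ x₁ x₂ →
  fromℕℚ 2 * b₀ + fromℕℚ 7 * b₁ + fromℕℚ 6 * x₁ + fromℕℚ 4 * x₂ + fromℕℚ 4 * s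
    ≡ fromℕℚ 6 * b₂ + fromℕℚ 3 * b₃ →
  s ≡ ℤ.+ 3 / 4 * b₃ + ℤ.+ 3 / 2 * b₂ + - (ℤ.+ 7 / 4) * b₁ + - 1ℚ * x₂ + - (ℤ.+ 3 / 2) * x₁ + - (ℤ.+ 1 / 2) * b₀
isolate s b₀ b₁ b₂ b₃ x₁ x₂ eq = begin
  s
    ≡⟨ solve (s ∷ b₀ ∷ b₁ ∷ x₁ ∷ x₂ ∷ []) ℚ-ring ⟩
  ℤ.+ 1 / 4 * (fromℕℚ 2 * b₀ + fromℕℚ 7 * b₁ + fromℕℚ 6 * x₁ + fromℕℚ 4 * x₂ + fromℕℚ 4 * s)
    + - (ℤ.+ 1 / 4) * (fromℕℚ 2 * b₀ + fromℕℚ 7 * b₁ + fromℕℚ 6 * x₁ + fromℕℚ 4 * x₂)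
    ≡⟨ cong (λ t → ℤ.+ 1 / 4 * t + - (ℤ.+ 1 / 4) * (fromℕℚ 2 * b₀ + fromℕℚ 7 * b₁ + fromℕℚ 6 * x₁ + fromℕℚ 4 * x₂))
            eq ⟩
  ℤ.+ 1 / 4 * (fromℕℚ 6 * b₂ + fromℕℚ 3 * b₃)
    + - (ℤ.+ 1 / 4) * (fromℕℚ 2 * b₀ + fromℕℚ 7 * b₁ + fromℕℚ 6 * x₁ + fromℕℚ 4 * x₂)
    ≡⟨ solve (b₀ ∷ b₁ ∷ b₂ ∷ b₃ ∷ x₁ ∷ x₂ ∷ []) ℚ-ring ⟩
  ℤ.+ 3 / 4 * b₃ + ℤ.+ 3 / 2 * b₂ + - (ℤ.+ 7 / 4) * b₁ + - 1ℚ * x₂ + - (ℤ.+ 3 / 2) * x₁ + - (ℤ.+ 1 / 2) * b₀ ∎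
  where open ≡-Reasoning

swrecSum-coeff : ∀ n → swrecSum 1 0 n /! n ≡ rhsCoeff n
swrecSum-coeff n = isolate S B₀ B₁ B₂ B₃ X₁ X₂ (begin
  fromℕℚ 2 * B₀ + fromℕℚ 7 * B₁ + fromℕℚ 6 * X₁ + fromℕℚ 4 * X₂ + fromℕℚ 4 * S
    ≡⟨ cong (λ t → t + fromℕℚ 7 * B₁ + fromℕℚ 6 * X₁ + fromℕℚ 4 * X₂ + fromℕℚ 4 * S) (/!-* 2 b₀ n) ⟨
  l₁ /! n + fromℕℚ 7 * B₁ + fromℕℚ 6 * X₁ + fromℕℚ 4 * X₂ + fromℕℚ 4 * S
    ≡⟨ cong (λ t → t + fromℕℚ 6 * X₁ + fromℕℚ 4 * X₂ + fromℕℚ 4 * S) (/!-+-* l₁ 7 b₁ n) ⟨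
  l₂ /! n + fromℕℚ 6 * X₁ + fromℕℚ 4 * X₂ + fromℕℚ 4 * S
    ≡⟨ cong (λ t → t + fromℕℚ 4 * X₂ + fromℕℚ 4 * S) (/!-+-* l₂ 6 x₁ n) ⟨
  l₃ /! n + fromℕℚ 4 * X₂ + fromℕℚ 4 * S
    ≡⟨ cong (_+ fromℕℚ 4 * S) (/!-+-* l₃ 4 x₂ n) ⟨
  l₄ /! n + fromℕℚ 4 * S
    ≡⟨ /!-+-* l₄ 4 s n ⟨
  (l₄ ℕ.+ 4 ℕ.* s) /! n
    ≡⟨ cong (_/! n) (swrecSum-closedForm₁₀ n) ⟩
  (6 ℕ.* b₂ ℕ.+ 3 ℕ.* b₃) /! n
    ≡⟨ /!-+-* (6 ℕ.* b₂) 3 b₃ n ⟩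
  (6 ℕ.* b₂) /! n + fromℕℚ 3 * B₃
    ≡⟨ cong (_+ fromℕℚ 3 * B₃) (/!-* 6 b₂ n) ⟩
  fromℕℚ 6 * B₂ + fromℕℚ 3 * B₃ ∎)
  where
  open ≡-Reasoning
  s  = swrecSum 1 0 n
  b₀ = rBell 0 n
  b₁ = rBell 1 n
  b₂ = rBell 2 n
  b₃ = rBell 3 n
  x₁ = xrBell 1 n
  x₂ = xrBell 2 n
  l₁ = 2 ℕ.* b₀
  l₂ = l₁ ℕ.+ 7 ℕ.* b₁
  l₃ = l₂ ℕ.+ 6 ℕ.* x₁
  l₄ = l₃ ℕ.+ 4 ℕ.* x₂
  S  = s /! n
  B₀ = b₀ /! n
  B₁ = b₁ /! n
  B₂ = b₂ /! n
  B₃ = b₃ /! n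
  X₁ = x₁ /! n
  X₂ = x₂ /! n

theorem2 : (n : ℕ) → lhsSeries n ≡ rhsSeries n
theorem2 n = begin
  lhsSeries n          ≡⟨ cong (_/! n) (totalSwrec≡swrecSum n) ⟩
  swrecSum 1 0 n /! n  ≡⟨ swrecSum-coeff n ⟩
  rhsCoeff n           ≡⟨ rhsSeries-coeff n ⟨
  rhsSeries n          ∎
  where open ≡-Reasoning
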